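{- Let $T$ be a rooted ordered tree and $\sigma=\Theta(T)$. Then the length of a longest increasing subsequence of $\sigma$ equals the number of leaves of $T$.
   Context: Permutations are written as words; an increasing subsequence of $\sigma_1\cdots\sigma_n$ is $\sigma_{i_1}\cdots\sigma_{i_k}$ with $i_1<\dots<i_k$ and $\sigma_{i_1}<\dots<\sigma_{i_k}$. For a rooted ordered tree $T$ with $n$ edges, $\Theta(T)$ is the permutation of $\{1,\dots,n\}$ obtained by labelling the edges $1,\dots,n$ in postfix depth-first order (children left to right; the edge from $v$ to its parent is labelled after all edges below $v$) and reading the labels in prefix depth-first order (the edge to $v$ is read when $v$ is first reached). A leaf is a non-root vertex with no children. -}

module Defs where

open import Data.Nat using (ℕ; zero; suc; _+_; _<_)
open import Data.List using (List; []; _∷_; length; _++_)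
open import Data.Product using (_×_)
open import Data.List.Relation.Binary.Sublist.Propositional using (_⊆_)
open import Data.List.Relation.Unary.Linked using (Linked)

data Tree : Set where
  node : List Tree → Tree

mutual
  edges : Tree → ℕ
  edges (node ts) = edgesF ts

  edgesF : List Tree → ℕ
  edgesF [] = zero
  edgesF (t ∷ ts) = suc (edges t) + edgesF ts

mutual
  -- number of leaves: non-root vertices with no children
  leaves : Tree → ℕ
  leaves (node ts) = leavesF ts

  leavesF : List Tree → ℕ
  leavesF [] = zero
  leavesF (node [] ∷ ts) = suc (leavesF ts)
  leavesF (node (c ∷ cs) ∷ ts) = leavesF (c ∷ cs) + leavesF ts

-- thetaF k ts : prefix-order reading of the postfix labels of the edges of
-- the forest ts, where k edges have already been labelled before it.
-- For a child t = node cs: the edges below it get labels k+1 .. k+edgesF cs,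
-- the edge to t gets label k + edgesF cs + 1 (postfix), and it is read
-- before the edges below t (prefix).
thetaF : ℕ → List Tree → List ℕ
thetaF k [] = []
thetaF k (node cs ∷ ts) =
  suc (k + edgesF cs) ∷ (thetaF k cs ++ thetaF (suc (k + edgesF cs)) ts)

Θ : Tree → List ℕ
Θ (node ts) = thetaF zero ts

IncreasingSubseq : List ℕ → List ℕ → Set
IncreasingSubseq τ σ = (τ ⊆ σ) × Linked _<_ τ

{-# OPTIONS --safe #-}
module Submission where

open import Defs
open import Data.Nat using (ℕ; suc; _+_; _<_; _≤_; z≤n; s≤s)
open import Data.Nat.Properties
open import Data.List using (List; []; _∷_; _++_; length)
open import Data.List.Properties using (length-++)
open import Data.Product using (_×_; _,_; Σ-syntax)
open import Data.List.Relation.Binary.Sublist.Propositional using (_⊆_; []; _∷_; _∷ʳ_)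
open import Data.List.Relation.Binary.Sublist.Propositional.Properties using (All-resp-⊆; ++⁺)
open import Data.List.Relation.Unary.All as All using (All; []; _∷_)
open import Data.List.Relation.Unary.AllPairs using (AllPairs; []; _∷_)
import Data.List.Relation.Unary.All.Properties as Allₚ
import Data.List.Relation.Unary.AllPairs.Properties as AllPairsₚ
open import Data.List.Relation.Unary.Linked.Properties using (Linked⇒AllPairs; AllPairs⇒Linked)
open import Relation.Binary.PropositionalEquality using (_≡_; refl; cong; cong₂; sym; trans)
open import Relation.Nullary using (contradiction)

-- In thetaF k (node cs ∷ rest) all labels below the child lie below its edge
-- label, which lies below all labels of the later siblings.  So an increasing
-- subsequence either uses the edge label and then nothing beneath it, or it is
-- an increasing subsequence beneath the child followed by one among the later
-- siblings; inductively it has at most as many entries as there are leaves.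
-- Conversely the edge labels of the leaves, in prefix order, increase.

⊆-++-split : ∀ {A : Set} {τ : List A} xs ys → τ ⊆ xs ++ ys →
             Σ[ a ∈ List A ] Σ[ b ∈ List A ] (τ ≡ a ++ b × a ⊆ xs × b ⊆ ys)
⊆-++-split []       ys τ⊆ = [] , _ , refl , [] , τ⊆
⊆-++-split (x ∷ xs) ys (.x ∷ʳ τ⊆) with ⊆-++-split xs ys τ⊆
... | a , b , refl , a⊆ , b⊆ = a , b , refl , x ∷ʳ a⊆ , b⊆
⊆-++-split (x ∷ xs) ys (refl ∷ τ⊆) with ⊆-++-split xs ys τ⊆
... | a , b , refl , a⊆ , b⊆ = x ∷ a , b , refl , refl ∷ a⊆ , b⊆

AllPairs-++⁻ : ∀ {A : Set} {R : A → A → Set} xs {ys} →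
               AllPairs R (xs ++ ys) → AllPairs R xs × AllPairs R ys
AllPairs-++⁻ []       rs       = [] , rs
AllPairs-++⁻ (x ∷ xs) (r ∷ rs) with AllPairs-++⁻ xs rs
... | rxs , rys = Allₚ.++⁻ˡ xs r ∷ rxs , rys

increasing-++⁺ : ∀ {t} {xs ys : List ℕ} → All (_≤ t) xs → All (t <_) ys →
                 AllPairs _<_ xs → AllPairs _<_ ys → AllPairs _<_ (xs ++ ys)
increasing-++⁺ xs≤t t<ys incxs incys =
  AllPairsₚ.++⁺ incxs incys (All.map (λ x≤t → All.map (≤-<-trans x≤t) t<ys) xs≤t)

thetaF-lower : ∀ k ts → All (k <_) (thetaF k ts)
thetaF-lower k []              = []
thetaF-lower k (node cs ∷ ts) =
  s≤s (m≤m+n k (edgesF cs))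
  ∷ Allₚ.++⁺ (thetaF-lower k cs)
            (All.map (<-trans (s≤s (m≤m+n k (edgesF cs)))) (thetaF-lower _ ts))

thetaF-upper : ∀ k ts → All (_≤ k + edgesF ts) (thetaF k ts)
thetaF-upper k []              = []
thetaF-upper k (node cs ∷ ts) =
  label≤ ∷ Allₚ.++⁺ (All.map (λ x≤ → ≤-trans x≤ (≤-trans (n≤1+n _) label≤)) (thetaF-upper k cs))
                    (All.map (λ x≤ → ≤-trans x≤ (≤-reflexive siblings-end≡)) (thetaF-upper _ ts))
  where
  e = edgesF cs
  E = edgesF ts
  siblings-end≡ : suc (k + e) + E ≡ k + (suc e + E)
  siblings-end≡ = trans (cong suc (+-assoc k e E)) (sym (+-suc k (e + E)))
  label≤ : suc (k + e) ≤ k + (suc e + E)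
  label≤ = ≤-trans (m≤m+n (suc (k + e)) E) (≤-reflexive siblings-end≡)

0<leavesF-∷ : ∀ c cs → 0 < leavesF (c ∷ cs)
0<leavesF-∷ (node [])        cs = s≤s z≤n
0<leavesF-∷ (node (c ∷ cs′)) cs = ≤-trans (0<leavesF-∷ c cs′) (m≤m+n _ _)

leavesF-children+siblings≤ : ∀ cs rest → leavesF cs + leavesF rest ≤ leavesF (node cs ∷ rest)
leavesF-children+siblings≤ []       rest = n≤1+n _
leavesF-children+siblings≤ (c ∷ cs) rest = ≤-refl

suc-leavesF-siblings≤ : ∀ cs rest → suc (leavesF rest) ≤ leavesF (node cs ∷ rest)
suc-leavesF-siblings≤ []       rest = ≤-refl
suc-leavesF-siblings≤ (c ∷ cs) rest = +-monoˡ-≤ (leavesF rest) (0<leavesF-∷ c cs)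

thetaF-increasing-length≤leavesF : ∀ k ts {τ} → τ ⊆ thetaF k ts → AllPairs _<_ τ →
                                   length τ ≤ leavesF ts
thetaF-increasing-length≤leavesF k [] [] [] = z≤n
thetaF-increasing-length≤leavesF k (node cs ∷ rest) (_ ∷ʳ τ⊆) incτ
  with ⊆-++-split (thetaF k cs) _ τ⊆
... | a , b , refl , a⊆ , b⊆ with AllPairs-++⁻ a incτ
... | inca , incb = begin
  length (a ++ b)            ≡⟨ length-++ a ⟩
  length a + length b        ≤⟨ +-mono-≤ (thetaF-increasing-length≤leavesF k cs a⊆ inca)
                                         (thetaF-increasing-length≤leavesF _ rest b⊆ incb) ⟩
  leavesF cs + leavesF rest  ≤⟨ leavesF-children+siblings≤ cs rest ⟩
  leavesF (node cs ∷ rest)   ∎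
  where open ≤-Reasoning
thetaF-increasing-length≤leavesF k (node cs ∷ rest) (refl ∷ τ⊆) (label< ∷ incτ)
  with ⊆-++-split (thetaF k cs) _ τ⊆
... | [] , b , refl , _ , b⊆ =
  ≤-trans (s≤s (thetaF-increasing-length≤leavesF _ rest b⊆ incτ)) (suc-leavesF-siblings≤ cs rest)
... | x ∷ a , b , refl , a⊆ , _ with All-resp-⊆ a⊆ (thetaF-upper k cs) | label<
...   | x≤ ∷ _ | label<x ∷ _ = contradiction (m≤n⇒m≤1+n x≤) (<⇒≱ label<x)

thetaF-increasing-of-length-leavesF : ∀ k ts →
  Σ[ τ ∈ List ℕ ] (τ ⊆ thetaF k ts × AllPairs _<_ τ × length τ ≡ leavesF ts)
thetaF-increasing-of-length-leavesF k [] = [] , [] , [] , refl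
thetaF-increasing-of-length-leavesF k (node [] ∷ rest)
  with thetaF-increasing-of-length-leavesF (suc (k + 0)) rest
... | τ , τ⊆ , incτ , len≡ =
  suc (k + 0) ∷ τ , refl ∷ τ⊆ , All-resp-⊆ τ⊆ (thetaF-lower _ rest) ∷ incτ , cong suc len≡
thetaF-increasing-of-length-leavesF k (node cs@(_ ∷ _) ∷ rest)
  with thetaF-increasing-of-length-leavesF k cs
     | thetaF-increasing-of-length-leavesF (suc (k + edgesF cs)) rest
... | τ₁ , τ₁⊆ , inc₁ , len₁ | τ₂ , τ₂⊆ , inc₂ , len₂ =
  τ₁ ++ τ₂ ,
  _ ∷ʳ ++⁺ τ₁⊆ τ₂⊆ ,
  increasing-++⁺ (All-resp-⊆ τ₁⊆ (thetaF-upper k cs))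
                 (All.map (<-trans (n<1+n _)) (All-resp-⊆ τ₂⊆ (thetaF-lower _ rest)))
                 inc₁ inc₂ ,
  trans (length-++ τ₁) (cong₂ _+_ len₁ len₂)

mainTheorem7 : (T : Tree) →
    (Σ[ τ ∈ List ℕ ] (IncreasingSubseq τ (Θ T) × length τ ≡ leaves T))
    × ((τ : List ℕ) → IncreasingSubseq τ (Θ T) → length τ ≤ leaves T)
mainTheorem7 (node ts) = longest , bounded
  where
  longest : Σ[ τ ∈ List ℕ ] (IncreasingSubseq τ (thetaF 0 ts) × length τ ≡ leavesF ts)
  longest with thetaF-increasing-of-length-leavesF 0 ts
  ... | τ , τ⊆ , incτ , len≡ = τ , (τ⊆ , AllPairs⇒Linked incτ) , len≡
  bounded : (τ : List ℕ) → IncreasingSubseq τ (thetaF 0 ts) → length τ ≤ leavesF ts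
  bounded τ (τ⊆ , incτ) = thetaF-increasing-length≤leavesF 0 ts τ⊆ (Linked⇒AllPairs <-trans incτ)
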